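{- Let $G$ be a finite, simple, connected graph and $k\ge 1$. Then the linear map $\eta^*:\mathscr{C}(G^k)\to\mathscr{C}(G^{(k)})$ induced by the natural projection $\eta:G^k\to G^{(k)}$ is surjective.
   Context: For a graph $H$, the edge space $\mathscr{E}(H)$ is the vector space over $\mathbb{F}_2$ of all subsets of $E(H)$ (addition = symmetric difference), and the vertex space $\mathscr{V}(H)$ is the analogous space of subsets of $V(H)$. The boundary map $\delta_H:\mathscr{E}(H)\to\mathscr{V}(H)$ is the linear map with $\delta_H(xy)=x+y$; the cycle space is $\mathscr{C}(H)=\ker\delta_H$. For $G$ with vertex set $\{a_1,\ldots,a_v\}$, $M_k(G)$ denotes the monic monomials of degree $k$ in commuting indeterminates $a_1,\ldots,a_v$; the reduced $k$th power $G^{(k)}$ has vertex set $M_k(G)$, with $a_if$ adjacent to $a_jf$ for every edge $a_ia_j$ of $G$ and every $f\in M_{k-1}(G)$. $G^k=G\Box\cdots\Box G$ is the $k$-fold Cartesian power (vertices are $k$-tuples, two tuples adjacent iff they differ in exactly one coordinate and those coordinates are adjacent in $G$). The map $\eta:V(G^k)\to M_k(G)$ sends $(x_1,\ldots,x_k)$ to the monomial $x_1x_2\cdots x_k$. The induced linear map $\eta^*:\mathscr{E}(G^k)\to\mathscr{E}(G^{(k)})$ is defined on edges by $\eta^*(xy)=\eta(x)\eta(y)$ if $\eta(x)\ne\eta(y)$ (this is then an edge of $G^{(k)}$) and $\eta^*(xy)=0$ otherwise; it maps $\mathscr{C}(G^k)$ into $\mathscr{C}(G^{(k)})$. -}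

module Defs where

open import Data.Nat using (ℕ; zero; suc; _∸_; _≤_)
open import Data.Nat.Properties using () renaming (_≟_ to _≟ℕ_)
open import Data.Bool using (Bool; true; false; _∧_; _∨_; _xor_; if_then_else_; not)
open import Data.Fin using (Fin) renaming (_≟_ to _≟F_)
open import Data.Fin.Properties using ()
open import Data.List using (List; []; _∷_; map; concat; concatMap; upTo; allFin; foldr)
open import Data.Bool.ListAction using (any)
open import Data.Vec using (Vec; []; _∷_; tabulate; updateAt)
open import Data.Vec.Properties using (≡-dec)
open import Data.Product using (_×_; Σ)
open import Relation.Nullary.Decidable using (⌊_⌋)
open import Relation.Binary.PropositionalEquality using (_≡_)

record FinGraph : Set₁ where
  field
    V     : Set
    verts : List V          -- enumeration of V(H) (each vertex exactly once)
    adj   : V → V → Bool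

xorSum : {A : Set} → List A → (A → Bool) → Bool
xorSum xs f = foldr (λ a b → f a xor b) false xs

-- An element of the edge space 𝓔(H): a subset of E(H), represented by its
-- (symmetric) indicator function on pairs of vertices, supported on edges.
EdgeFn : Set → Set
EdgeFn V = V → V → Bool

module _ (H : FinGraph) where
  open FinGraph H

  IsEdgeSet : EdgeFn V → Set
  IsEdgeSet c = (∀ x y → c x y ≡ c y x) × (∀ x y → c x y ≡ true → adj x y ≡ true)

  -- boundary map δ_H : 𝓔(H) → 𝓥(H), δ_H(xy) = x + y
  boundary : EdgeFn V → V → Bool
  boundary c x = xorSum verts (c x)

  IsCycle : EdgeFn V → Set
  IsCycle c = IsEdgeSet c × (∀ x → boundary c x ≡ false)

-- The base graph G on vertices a_0,…,a_{v-1} (= Fin v)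

module _ {v : ℕ} (adj : Fin v → Fin v → Bool) where

  SymmetricAdj : Set
  SymmetricAdj = ∀ x y → adj x y ≡ adj y x

  IrreflexiveAdj : Set
  IrreflexiveAdj = ∀ x → adj x x ≡ false

  data Reach : Fin v → Fin v → Set where
    here : ∀ {x} → Reach x x
    step : ∀ {x y z} → adj x y ≡ true → Reach y z → Reach x z

  Connected : Set
  Connected = ∀ x y → Reach x y

_==F_ : {v : ℕ} → Fin v → Fin v → Bool
x ==F y = ⌊ x ≟F y ⌋

_==T_ : {v k : ℕ} → Vec (Fin v) k → Vec (Fin v) k → Bool
xs ==T ys = ⌊ ≡-dec _≟F_ xs ys ⌋

allTuples : (v k : ℕ) → List (Vec (Fin v) k)
allTuples v zero    = [] ∷ []
allTuples v (suc k) = concatMap (λ x → map (x ∷_) (allTuples v k)) (allFin v)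

powAdj : {v k : ℕ} → (Fin v → Fin v → Bool) → Vec (Fin v) k → Vec (Fin v) k → Bool
powAdj adj []       []       = false
powAdj adj (x ∷ xs) (y ∷ ys) = (adj x y ∧ (xs ==T ys)) ∨ ((x ==F y) ∧ powAdj adj xs ys)

Pow : (v : ℕ) → (Fin v → Fin v → Bool) → ℕ → FinGraph
Pow v adj k = record { V = Vec (Fin v) k ; verts = allTuples v k ; adj = powAdj adj }

-- Monomials: a monic monomial a_0^{e_0} ⋯ a_{v-1}^{e_{v-1}} is represented
-- by its exponent vector (e_0,…,e_{v-1}) : Vec ℕ v.

_==M_ : {v : ℕ} → Vec ℕ v → Vec ℕ v → Bool
m ==M m' = ⌊ ≡-dec _≟ℕ_ m m' ⌋

-- M_k for v indeterminates: all exponent vectors of total degree k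
monos : (v k : ℕ) → List (Vec ℕ v)
monos zero    zero    = [] ∷ []
monos zero    (suc k) = []
monos (suc v) k       = concatMap (λ e → map (e ∷_) (monos v (k ∸ e))) (upTo (suc k))

mulVar : {v : ℕ} → Fin v → Vec ℕ v → Vec ℕ v
mulVar i f = updateAt f i suc

redAdj : {v : ℕ} → (Fin v → Fin v → Bool) → ℕ → Vec ℕ v → Vec ℕ v → Bool
redAdj {v} adj k m m' =
  any (λ i → any (λ j → any (λ f → adj i j ∧ (m ==M mulVar i f) ∧ (m' ==M mulVar j f))
                               (monos v (k ∸ 1)))
             (allFin v))
      (allFin v)

Red : (v : ℕ) → (Fin v → Fin v → Bool) → ℕ → FinGraph
Red v adj k = record { V = Vec ℕ v ; verts = monos v k ; adj = redAdj adj k }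

-- η : V(G^k) → M_k(G), (x_1,…,x_k) ↦ x_1 ⋯ x_k

count : {v k : ℕ} → Fin v → Vec (Fin v) k → ℕ
count i []       = 0
count i (x ∷ xs) = if x ==F i then suc (count i xs) else count i xs

η : {v k : ℕ} → Vec (Fin v) k → Vec ℕ v
η xs = tabulate (λ i → count i xs)

-- η* : 𝓔(G^k) → 𝓔(G^(k)), linear extension of xy ↦ η(x)η(y) (or 0 if η(x)=η(y)).
-- For m ≠ m', the coefficient of the pair {m,m'} in η*(c) is the F₂-sum of c
-- over the edges xy with η(x)=m, η(y)=m' (each unordered edge counted once,
-- as exactly one orientation matches).
etaStar : {v k : ℕ} → EdgeFn (Vec (Fin v) k) → EdgeFn (Vec ℕ v)
etaStar {v} {k} c m m' =
  if m ==M m' then false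
  else xorSum (allTuples v k) (λ x → xorSum (allTuples v k)
         (λ y → (η x ==M m) ∧ (η y ==M m') ∧ c x y))

module Submission where

-- Write k = n+1.  Every arc of G^(n+1) is a_i f → a_j f with a_i a_j ∈ E(G)
-- and f ∈ M_n, for exactly one triple (i , j , f) (ArcDecomposition).  Fix a
-- canonical tuple home(m) over each monomial m and lift the arc to the edge
-- (i ∷ w_f , j ∷ w_f) of G^(n+1), where w_f is canonical over f, plus a null
-- chain from i ∷ w_f to home(a_i f): edges with boundary i ∷ w_f + home(a_i f)
-- whose η-images cancel.  Null chains join any two tuples over the same
-- monomial since G is connected: a transposition of two coordinates is
-- realised by two parallel walks (NullChains).  The sum c of the lifts of
-- all arcs of d (each edge of d is two arcs) is symmetric, has η*(c) = d, and
-- its boundary at x is [x = home(η x)] times the boundary of d at η x, i.e. 0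
-- (Lift).

open import Defs
open import Data.Nat using (ℕ; zero; suc; _+_; _∸_; _≤_; _<_; s≤s)
open import Data.Nat.Properties using (suc-injective; m+[n∸m]≡n; m+n∸m≡n; m≤m+n; 1+n≢n; m≢1+n+m; +-suc) renaming (_≟_ to _≟ℕ_)
open import Data.Fin using (Fin) renaming (zero to fz; suc to fs; _≟_ to _≟F_)
import Data.Fin.Properties as Fin
open import Data.Bool using (Bool; true; false; _∧_; _∨_; _xor_; if_then_else_)
open import Data.Bool.Properties
  using (xor-assoc; xor-comm; xor-same; xor-identityʳ; ∧-comm; ∧-assoc; ∧-zeroʳ; ∧-identityʳ; ∧-distribˡ-xor; ∨-zeroʳ;
         ∧-commutativeMonoid; xor-∧-commutativeRing)
open import Data.Bool.ListAction using (any)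
open import Data.Vec using (Vec; []; _∷_; sum; lookup; _[_]≔_; replicate) renaming (_++_ to _++ᵥ_)
import Data.Vec as Vec
open import Data.Vec.Properties
  using (≡-dec; ∷-injective; lookup∘updateAt; lookup∘updateAt′; updateAt-commutes; lookup∘tabulate; tabulate∘lookup; tabulate-cong; []≔-lookup)
open import Data.List using (List; []; _∷_; map; concatMap; upTo; applyUpTo; allFin; tabulate; _++_)
open import Data.List.Properties using (map-tabulate; map-applyUpTo)
open import Data.List.Relation.Unary.All using (All; []; _∷_)
import Data.List.Relation.Unary.All as All
import Data.List.Relation.Unary.All.Properties as All
open import Data.Product using (Σ; _×_; _,_; proj₁; proj₂)
open import Data.Product.Properties using (,-injective) renaming (≡-dec to ×-≡-dec)
open import Data.Sum using (_⊎_; inj₁; inj₂)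
open import Data.Unit using (⊤; tt)
open import Data.Empty using (⊥; ⊥-elim)
open import Relation.Nullary using (Dec; yes; no; ¬_)
open import Relation.Nullary.Decidable using (⌊_⌋; isYes≗does; dec-true; dec-false; does-⇔)
open import Relation.Binary.Definitions using (DecidableEquality)
open import Relation.Binary.PropositionalEquality using (_≡_; refl; sym; trans; cong; cong₂; subst; subst₂; _≢_)
open Relation.Binary.PropositionalEquality.≡-Reasoning
open import Function using (_∘_; id; mk⇔)
open import Algebra.Bundles using (CommutativeRing; CommutativeMonoid)
import Algebra.Properties.CommutativeSemigroup as CommutativeSemigroupProperties
open CommutativeSemigroupProperties (CommutativeMonoid.commutativeSemigroup ∧-commutativeMonoid)
  using () renaming (x∙yz≈y∙xz to ∧-exchange; xy∙z≈y∙xz to ∧-assoc-exchange)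
open CommutativeSemigroupProperties (CommutativeRing.+-commutativeSemigroup xor-∧-commutativeRing)
  using () renaming (interchange to xor-interchange)

module _ {P : Set} where

  ⌊⌋-yes : (p? : Dec P) → P → ⌊ p? ⌋ ≡ true
  ⌊⌋-yes p? p = trans (isYes≗does p?) (dec-true p? p)

  ⌊⌋-no : (p? : Dec P) → ¬ P → ⌊ p? ⌋ ≡ false
  ⌊⌋-no p? ¬p = trans (isYes≗does p?) (dec-false p? ¬p)

  ⌊⌋-sound : (p? : Dec P) → ⌊ p? ⌋ ≡ true → P
  ⌊⌋-sound (yes p) _ = p

⌊⌋-⇔ : {P Q : Set} (p? : Dec P) (q? : Dec Q) → (P → Q) → (Q → P) → ⌊ p? ⌋ ≡ ⌊ q? ⌋
⌊⌋-⇔ p? q? f g = trans (isYes≗does p?) (trans (does-⇔ (mk⇔ f g) p? q?) (sym (isYes≗does q?)))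

⌊⌋-× : {P Q R : Set} (p? : Dec P) (q? : Dec Q) (r? : Dec R) →
       (P → Q → R) → (R → P × Q) → ⌊ r? ⌋ ≡ ⌊ p? ⌋ ∧ ⌊ q? ⌋
⌊⌋-× (yes p) (yes q) r? mk split = ⌊⌋-yes r? (mk p q)
⌊⌋-× (yes _) (no ¬q) r? mk split = ⌊⌋-no r? (¬q ∘ proj₂ ∘ split)
⌊⌋-× (no ¬p) q?      r? mk split = ⌊⌋-no r? (¬p ∘ proj₁ ∘ split)

∧-guard : {P Q : Set} {x y : Bool} (p? : Dec P) (q? : Dec Q) → (P → Q → x ≡ y) →
          x ∧ (⌊ p? ⌋ ∧ ⌊ q? ⌋) ≡ y ∧ (⌊ p? ⌋ ∧ ⌊ q? ⌋)
∧-guard {x = x} {y} (yes p) (yes q) x≡y = cong (_∧ true) (x≡y p q)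
∧-guard {x = x} {y} (yes _) (no _)  _   = trans (∧-zeroʳ x) (sym (∧-zeroʳ y))
∧-guard {x = x} {y} (no _)  _       _   = trans (∧-zeroʳ x) (sym (∧-zeroʳ y))

∧-interchange : ∀ a b c d → a ∧ (b ∧ (c ∧ d)) ≡ (a ∧ c) ∧ (b ∧ d)
∧-interchange a b c d = begin
  a ∧ (b ∧ (c ∧ d))  ≡⟨ cong (a ∧_) (∧-exchange b c d) ⟩
  a ∧ (c ∧ (b ∧ d))  ≡⟨ sym (∧-assoc a c _) ⟩
  (a ∧ c) ∧ (b ∧ d)  ∎

true≢false : true ≢ false
true≢false ()

∧-true : ∀ {a b} → a ∧ b ≡ true → a ≡ true × b ≡ true
∧-true {true} e = refl , e

xor-true : ∀ {a b} → a xor b ≡ true → a ≡ true ⊎ b ≡ true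
xor-true {true}  _ = inj₁ refl
xor-true {false} e = inj₂ e

xor-cancelˡ : ∀ a b → a xor (a xor b) ≡ b
xor-cancelˡ a b = trans (sym (xor-assoc a a b)) (cong (_xor b) (xor-same a))

xor-cancel-middle : ∀ a b c → (a xor b) xor (b xor c) ≡ a xor c
xor-cancel-middle a b c = begin
  (a xor b) xor (b xor c)  ≡⟨ xor-assoc a b _ ⟩
  a xor (b xor (b xor c))  ≡⟨ cong (a xor_) (sym (xor-assoc b b c)) ⟩
  a xor ((b xor b) xor c)  ≡⟨ cong (λ z → a xor (z xor c)) (xor-same b) ⟩
  a xor c                  ∎

module _ {A : Set} where

  xorSum-cong : (xs : List A) {f g : A → Bool} → (∀ x → f x ≡ g x) → xorSum xs f ≡ xorSum xs g
  xorSum-cong []       e = refl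
  xorSum-cong (x ∷ xs) e = cong₂ _xor_ (e x) (xorSum-cong xs e)

  xorSum-congᴬ : {Q : A → Set} (xs : List A) {f g : A → Bool} →
                 All Q xs → (∀ x → Q x → f x ≡ g x) → xorSum xs f ≡ xorSum xs g
  xorSum-congᴬ []       []       e = refl
  xorSum-congᴬ (x ∷ xs) (q ∷ qs) e = cong₂ _xor_ (e x q) (xorSum-congᴬ xs qs e)

  xorSum-zero : (xs : List A) {f : A → Bool} → (∀ x → f x ≡ false) → xorSum xs f ≡ false
  xorSum-zero []       e = refl
  xorSum-zero (x ∷ xs) e = cong₂ _xor_ (e x) (xorSum-zero xs e)

  xorSum-xor : (xs : List A) (f g : A → Bool) →
               xorSum xs (λ x → f x xor g x) ≡ xorSum xs f xor xorSum xs g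
  xorSum-xor []       f g = refl
  xorSum-xor (x ∷ xs) f g = begin
    (f x xor g x) xor xorSum xs (λ y → f y xor g y)  ≡⟨ cong ((f x xor g x) xor_) (xorSum-xor xs f g) ⟩
    (f x xor g x) xor (xorSum xs f xor xorSum xs g)  ≡⟨ xor-interchange (f x) (g x) _ _ ⟩
    (f x xor xorSum xs f) xor (g x xor xorSum xs g)  ∎

  xorSum-∧ˡ : (xs : List A) (b : Bool) (f : A → Bool) → xorSum xs (λ x → b ∧ f x) ≡ b ∧ xorSum xs f
  xorSum-∧ˡ []       b f = sym (∧-zeroʳ b)
  xorSum-∧ˡ (x ∷ xs) b f = trans (cong ((b ∧ f x) xor_) (xorSum-∧ˡ xs b f)) (sym (∧-distribˡ-xor b (f x) _))

  xorSum-∧ʳ : (xs : List A) (b : Bool) (f : A → Bool) → xorSum xs (λ x → f x ∧ b) ≡ xorSum xs f ∧ b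
  xorSum-∧ʳ xs b f = trans (xorSum-cong xs (λ x → ∧-comm (f x) b)) (trans (xorSum-∧ˡ xs b f) (∧-comm b _))

  xorSum-weighted-xor : (xs : List A) (w f g : A → Bool) →
                        xorSum xs (λ x → w x ∧ (f x xor g x)) ≡ xorSum xs (λ x → w x ∧ f x) xor xorSum xs (λ x → w x ∧ g x)
  xorSum-weighted-xor xs w f g =
    trans (xorSum-cong xs (λ x → ∧-distribˡ-xor (w x) (f x) (g x))) (xorSum-xor xs (λ x → w x ∧ f x) (λ x → w x ∧ g x))

  xorSum-++ : (xs ys : List A) (f : A → Bool) → xorSum (xs ++ ys) f ≡ xorSum xs f xor xorSum ys f
  xorSum-++ []       ys f = refl
  xorSum-++ (x ∷ xs) ys f = trans (cong (f x xor_) (xorSum-++ xs ys f)) (sym (xor-assoc (f x) _ _))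

  xorSum-witness : {Q : A → Set} (xs : List A) (f : A → Bool) → All Q xs →
                   xorSum xs f ≡ true → Σ A (λ x → Q x × f x ≡ true)
  xorSum-witness (x ∷ xs) f (q ∷ qs) e with f x in fx
  ... | true  = x , q , fx
  ... | false = xorSum-witness xs f qs e

  any-witness : {Q : A → Set} (xs : List A) (f : A → Bool) → All Q xs →
                any f xs ≡ true → Σ A (λ x → Q x × f x ≡ true)
  any-witness (x ∷ xs) f (q ∷ qs) e with f x in fx
  ... | true  = x , q , fx
  ... | false = any-witness xs f qs e

module _ {A B : Set} where

  xorSum-map : (xs : List A) (h : A → B) (f : B → Bool) → xorSum (map h xs) f ≡ xorSum xs (f ∘ h)
  xorSum-map []       h f = refl
  xorSum-map (x ∷ xs) h f = cong (f (h x) xor_) (xorSum-map xs h f)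

  xorSum-concatMap : (xs : List A) (h : A → List B) (f : B → Bool) →
                     xorSum (concatMap h xs) f ≡ xorSum xs (λ a → xorSum (h a) f)
  xorSum-concatMap []       h f = refl
  xorSum-concatMap (x ∷ xs) h f =
    trans (xorSum-++ (h x) (concatMap h xs) f) (cong (xorSum (h x) f xor_) (xorSum-concatMap xs h f))

  xorSum-swap : (xs : List A) (ys : List B) (f : A → B → Bool) →
                xorSum xs (λ a → xorSum ys (f a)) ≡ xorSum ys (λ b → xorSum xs (λ a → f a b))
  xorSum-swap []       ys f = sym (xorSum-zero ys (λ _ → refl))
  xorSum-swap (x ∷ xs) ys f =
    trans (cong (xorSum ys (f x) xor_) (xorSum-swap xs ys f)) (sym (xorSum-xor ys (f x) _))

  xorSum-linear : (xs : List A) (ys : List B) (w : A → Bool) (g : A → B → Bool) →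
                  xorSum ys (λ b → xorSum xs (λ a → w a ∧ g a b)) ≡ xorSum xs (λ a → w a ∧ xorSum ys (g a))
  xorSum-linear xs ys w g =
    trans (sym (xorSum-swap xs ys (λ a b → w a ∧ g a b))) (xorSum-cong xs (λ a → xorSum-∧ˡ ys (w a) (g a)))

module _ {A : Set} (_≟_ : DecidableEquality A) where

  -- xs contains a an odd number of times: the F₂-count of a in xs is 1
  OnceIn : List A → A → Set
  OnceIn xs a = xorSum xs (λ x → ⌊ x ≟ a ⌋) ≡ true

  xorSum-single : (xs : List A) (f : A → Bool) (a : A) → OnceIn xs a →
                  (∀ x → f x ≡ true → x ≡ a) → xorSum xs f ≡ f a
  xorSum-single xs f a once supp = begin
    xorSum xs f                         ≡⟨ xorSum-cong xs term ⟩
    xorSum xs (λ x → ⌊ x ≟ a ⌋ ∧ f a)   ≡⟨ xorSum-∧ʳ xs (f a) (λ x → ⌊ x ≟ a ⌋) ⟩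
    xorSum xs (λ x → ⌊ x ≟ a ⌋) ∧ f a   ≡⟨ cong (_∧ f a) once ⟩
    f a                                 ∎
    where
    term : ∀ x → f x ≡ ⌊ x ≟ a ⌋ ∧ f a
    term x with x ≟ a | f x in fx
    ... | yes refl | _     = sym fx
    ... | no  x≢a  | true  = ⊥-elim (x≢a (supp x fx))
    ... | no  _    | false = refl

  xorSum-sift : (xs : List A) (f : A → Bool) (a : A) → OnceIn xs a →
                xorSum xs (λ x → f x ∧ ⌊ x ≟ a ⌋) ≡ f a
  xorSum-sift xs f a once =
    trans (xorSum-single xs (λ x → f x ∧ ⌊ x ≟ a ⌋) a once support)
          (trans (cong (f a ∧_) (⌊⌋-yes (a ≟ a) refl)) (∧-identityʳ (f a)))
    where
    support : ∀ x → f x ∧ ⌊ x ≟ a ⌋ ≡ true → x ≡ a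
    support x e = ⌊⌋-sound (x ≟ a) (proj₂ (∧-true e))

once-concatMap : {A B C : Set} (_≟A_ : DecidableEquality A) (_≟B_ : DecidableEquality B)
                 (_≟C_ : DecidableEquality C) (h : A → B → C) →
                 (∀ {a a' b b'} → h a b ≡ h a' b' → a ≡ a' × b ≡ b') →
                 (xs : List A) (ys : A → List B) {a : A} {b : B} →
                 OnceIn _≟A_ xs a → OnceIn _≟B_ (ys a) b →
                 OnceIn _≟C_ (concatMap (λ a' → map (h a') (ys a')) xs) (h a b)
once-concatMap {A} _≟A_ _≟B_ _≟C_ h h-inj xs ys {a} {b} onceA onceB = begin
  xorSum (concatMap (λ a' → map (h a') (ys a')) xs) (λ c → ⌊ c ≟C h a b ⌋)
    ≡⟨ xorSum-concatMap xs (λ a' → map (h a') (ys a')) (λ c → ⌊ c ≟C h a b ⌋) ⟩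
  xorSum xs (λ a' → xorSum (map (h a') (ys a')) (λ c → ⌊ c ≟C h a b ⌋))
    ≡⟨ xorSum-cong xs (λ a' → trans (xorSum-map (ys a') (h a') (λ c → ⌊ c ≟C h a b ⌋))
                                     (xorSum-cong (ys a') (split a'))) ⟩
  xorSum xs (λ a' → xorSum (ys a') (λ b' → ⌊ a' ≟A a ⌋ ∧ ⌊ b' ≟B b ⌋))
    ≡⟨ xorSum-cong xs (λ a' → xorSum-∧ˡ (ys a') ⌊ a' ≟A a ⌋ (λ b' → ⌊ b' ≟B b ⌋)) ⟩
  xorSum xs (λ a' → ⌊ a' ≟A a ⌋ ∧ multiplicity a')
    ≡⟨ xorSum-single _≟A_ xs (λ a' → ⌊ a' ≟A a ⌋ ∧ multiplicity a') a onceA (λ a' e → ⌊⌋-sound (a' ≟A a) (proj₁ (∧-true e))) ⟩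
  ⌊ a ≟A a ⌋ ∧ multiplicity a
    ≡⟨ cong₂ _∧_ (⌊⌋-yes (a ≟A a) refl) onceB ⟩
  true ∎
  where
  multiplicity : A → Bool
  multiplicity a' = xorSum (ys a') (λ b' → ⌊ b' ≟B b ⌋)
  split : ∀ a' b' → ⌊ h a' b' ≟C h a b ⌋ ≡ ⌊ a' ≟A a ⌋ ∧ ⌊ b' ≟B b ⌋
  split a' b' = ⌊⌋-× (a' ≟A a) (b' ≟B b) (h a' b' ≟C h a b) (cong₂ h) h-inj

once-map : {A B : Set} (_≟A_ : DecidableEquality A) (_≟B_ : DecidableEquality B)
           (h : A → B) → (∀ {a a'} → h a ≡ h a' → a ≡ a') →
           (xs : List A) {a : A} → OnceIn _≟A_ xs a → OnceIn _≟B_ (map h xs) (h a)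
once-map _≟A_ _≟B_ h h-inj xs {a} once =
  trans (xorSum-map xs h (λ y → ⌊ y ≟B h a ⌋))
        (trans (xorSum-cong xs (λ x → ⌊⌋-⇔ (h x ≟B h a) (x ≟A a) h-inj (cong h))) once)

_≟T_ : {v k : ℕ} → DecidableEquality (Vec (Fin v) k)
_≟T_ = ≡-dec _≟F_

_≟M_ : {v : ℕ} → DecidableEquality (Vec ℕ v)
_≟M_ = ≡-dec _≟ℕ_

once-allFin : ∀ n (i : Fin n) → OnceIn _≟F_ (allFin n) i
once-allFin (suc n) fz = cong (true xor_) (begin
  xorSum (tabulate (fs {n})) (λ j → ⌊ j ≟F fz ⌋)  ≡⟨ cong (λ l → xorSum l (λ j → ⌊ j ≟F fz ⌋)) (sym (map-tabulate {n = n} id fs)) ⟩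
  xorSum (map fs (allFin n)) (λ j → ⌊ j ≟F fz ⌋)  ≡⟨ xorSum-map (allFin n) fs (λ j → ⌊ j ≟F fz ⌋) ⟩
  xorSum (allFin n) (λ j → false)                 ≡⟨ xorSum-zero (allFin n) (λ _ → refl) ⟩
  false                                           ∎)
once-allFin (suc n) (fs i) =
  subst (λ l → OnceIn _≟F_ l (fs i)) (map-tabulate {n = n} id fs) (once-map _≟F_ _≟F_ fs Fin.suc-injective (allFin n) (once-allFin n i))

once-upTo : ∀ n e → e < n → OnceIn _≟ℕ_ (upTo n) e
once-upTo (suc n) zero    _ = cong (true xor_) (begin
  xorSum (applyUpTo suc n) (λ j → ⌊ j ≟ℕ 0 ⌋)   ≡⟨ cong (λ l → xorSum l (λ j → ⌊ j ≟ℕ 0 ⌋)) (sym (map-applyUpTo id suc n)) ⟩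
  xorSum (map suc (upTo n)) (λ j → ⌊ j ≟ℕ 0 ⌋)  ≡⟨ xorSum-map (upTo n) suc (λ j → ⌊ j ≟ℕ 0 ⌋) ⟩
  xorSum (upTo n) (λ j → false)                 ≡⟨ xorSum-zero (upTo n) (λ _ → refl) ⟩
  false                                         ∎)
once-upTo (suc n) (suc e) (s≤s e<n) =
  subst (λ l → OnceIn _≟ℕ_ l (suc e)) (map-applyUpTo id suc n) (once-map _≟ℕ_ _≟ℕ_ suc suc-injective (upTo n) (once-upTo n e e<n))

once-allTuples : ∀ v k (t : Vec (Fin v) k) → OnceIn _≟T_ (allTuples v k) t
once-allTuples v zero    []      = refl
once-allTuples v (suc k) (a ∷ t) =
  once-concatMap _≟F_ _≟T_ _≟T_ _∷_ ∷-injective (allFin v) (λ _ → allTuples v k)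
                 (once-allFin v a) (once-allTuples v k t)

once-monos : ∀ v k (m : Vec ℕ v) → sum m ≡ k → OnceIn _≟M_ (monos v k) m
once-monos zero    zero    []      _     = refl
once-monos (suc v) k       (e ∷ m) refl =
  once-concatMap _≟ℕ_ _≟M_ _≟M_ _∷_ ∷-injective (upTo (suc k)) (λ e' → monos v (k ∸ e'))
                 (once-upTo (suc k) e (s≤s (m≤m+n e (sum m))))
                 (once-monos v (k ∸ e) m (sym (m+n∸m≡n e (sum m))))

monos-degree : ∀ v k → All (λ m → sum m ≡ k) (monos v k)
monos-degree zero    zero    = refl ∷ []
monos-degree zero    (suc k) = []
monos-degree (suc v) k       = All.concat⁺ (All.map⁺ (All.applyUpTo⁺₁ id (suc k) column))
  where
  column : ∀ {e} → e < suc k → All (λ m → sum m ≡ k) (map (e ∷_) (monos v (k ∸ e)))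
  column {e} (s≤s e≤k) = All.map⁺ (All.map (λ s → trans (cong (e +_) s) (m+[n∸m]≡n e≤k)) (monos-degree v (k ∸ e)))

mulVar-here : ∀ {v} (i : Fin v) (f : Vec ℕ v) → lookup (mulVar i f) i ≡ suc (lookup f i)
mulVar-here i f = lookup∘updateAt i f

mulVar-elsewhere : ∀ {v} {i j : Fin v} (f : Vec ℕ v) → i ≢ j → lookup (mulVar i f) j ≡ lookup f j
mulVar-elsewhere {i = i} {j} f i≢j = lookup∘updateAt′ j i (i≢j ∘ sym) f

mulVar-comm : ∀ {v} (i j : Fin v) (f : Vec ℕ v) → mulVar i (mulVar j f) ≡ mulVar j (mulVar i f)
mulVar-comm i j f with i ≟F j
... | yes refl = refl
... | no  i≢j  = updateAt-commutes i j i≢j f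

mulVar-injective : ∀ {v} (i : Fin v) {f g : Vec ℕ v} → mulVar i f ≡ mulVar i g → f ≡ g
mulVar-injective fz     {x ∷ f} {y ∷ g} e with ∷-injective e
... | x≡y , f≡g = cong₂ _∷_ (suc-injective x≡y) f≡g
mulVar-injective (fs i) {x ∷ f} {y ∷ g} e with ∷-injective e
... | x≡y , f≡g = cong₂ _∷_ x≡y (mulVar-injective i f≡g)

mulVar-injectiveˡ : ∀ {v} {i j : Fin v} (f : Vec ℕ v) → mulVar i f ≡ mulVar j f → i ≡ j
mulVar-injectiveˡ {i = i} {j} f e with i ≟F j
... | yes i≡j = i≡j
... | no  i≢j = ⊥-elim (1+n≢n (begin
  suc (lookup f i)       ≡⟨ sym (mulVar-here i f) ⟩
  lookup (mulVar i f) i  ≡⟨ cong (λ m → lookup m i) e ⟩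
  lookup (mulVar j f) i  ≡⟨ mulVar-elsewhere f (i≢j ∘ sym) ⟩
  lookup f i             ∎))

sum-mulVar : ∀ {v} (i : Fin v) (f : Vec ℕ v) → sum (mulVar i f) ≡ suc (sum f)
sum-mulVar fz     (x ∷ f) = refl
sum-mulVar (fs i) (x ∷ f) = trans (cong (x +_) (sum-mulVar i f)) (+-suc x (sum f))

lookup-ext : ∀ {A : Set} {n} {xs ys : Vec A n} → (∀ i → lookup xs i ≡ lookup ys i) → xs ≡ ys
lookup-ext {xs = xs} {ys} e =
  trans (sym (tabulate∘lookup xs)) (trans (tabulate-cong e) (tabulate∘lookup ys))

lookup-η : ∀ {v k} (t : Vec (Fin v) k) (i : Fin v) → lookup (η t) i ≡ count i t
lookup-η t i = lookup∘tabulate (λ j → count j t) i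

η-cons : ∀ {v k} (a : Fin v) (t : Vec (Fin v) k) → η (a ∷ t) ≡ mulVar a (η t)
η-cons a t = lookup-ext (λ i → trans (lookup-η (a ∷ t) i) (count-cons i))
  where
  count-cons : ∀ i → (if ⌊ a ≟F i ⌋ then suc (count i t) else count i t) ≡ lookup (mulVar a (η t)) i
  count-cons i with a ≟F i
  ... | yes refl = sym (trans (mulVar-here a (η t)) (cong suc (lookup-η t a)))
  ... | no  a≢i  = sym (trans (mulVar-elsewhere (η t) a≢i) (lookup-η t i))

η-cancel : ∀ {v k} (a : Fin v) (x y : Vec (Fin v) k) → η (a ∷ x) ≡ η (a ∷ y) → η x ≡ η y
η-cancel a x y e = mulVar-injective a (trans (sym (η-cons a x)) (trans e (η-cons a y)))

η-replace : ∀ {v k} (t : Vec (Fin v) k) (q : Fin k) {a : Fin v} (u : Fin v) → lookup t q ≡ a →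
            mulVar a (η (t [ q ]≔ u)) ≡ mulVar u (η t)
η-replace (b ∷ t) fz     u refl = begin
  mulVar b (η (u ∷ t))           ≡⟨ cong (mulVar b) (η-cons u t) ⟩
  mulVar b (mulVar u (η t))      ≡⟨ mulVar-comm b u (η t) ⟩
  mulVar u (mulVar b (η t))      ≡⟨ cong (mulVar u) (sym (η-cons b t)) ⟩
  mulVar u (η (b ∷ t))           ∎
η-replace (b ∷ t) (fs q) {a} u e = begin
  mulVar a (η (b ∷ (t [ q ]≔ u)))       ≡⟨ cong (mulVar a) (η-cons b (t [ q ]≔ u)) ⟩
  mulVar a (mulVar b (η (t [ q ]≔ u)))  ≡⟨ mulVar-comm a b _ ⟩
  mulVar b (mulVar a (η (t [ q ]≔ u)))  ≡⟨ cong (mulVar b) (η-replace t q u e) ⟩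
  mulVar b (mulVar u (η t))             ≡⟨ mulVar-comm b u (η t) ⟩
  mulVar u (mulVar b (η t))             ≡⟨ cong (mulVar u) (sym (η-cons b t)) ⟩
  mulVar u (η (b ∷ t))                  ∎

occurs : ∀ {v k} (a : Fin v) (t : Vec (Fin v) k) {r : ℕ} → count a t ≡ suc r → Σ (Fin k) (λ q → lookup t q ≡ a)
occurs a (b ∷ t) e with b ≟F a
... | yes b≡a = fz , b≡a
... | no  _   = let q , tq≡a = occurs a t e in fs q , tq≡a

occurs-in-other : ∀ {v k} {a b : Fin v} (x y : Vec (Fin v) k) → a ≢ b →
                  η (a ∷ x) ≡ η (b ∷ y) → Σ (Fin k) (λ q → lookup y q ≡ a)
occurs-in-other {a = a} {b} x y a≢b e = occurs a y (begin
  count a y                    ≡⟨ sym (lookup-η y a) ⟩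
  lookup (η y) a               ≡⟨ sym (mulVar-elsewhere (η y) (a≢b ∘ sym)) ⟩
  lookup (mulVar b (η y)) a    ≡⟨ cong (λ m → lookup m a) (sym (trans e (η-cons b y))) ⟩
  lookup (η (a ∷ x)) a         ≡⟨ cong (λ m → lookup m a) (η-cons a x) ⟩
  lookup (mulVar a (η x)) a    ≡⟨ mulVar-here a (η x) ⟩
  suc (lookup (η x) a)         ∎)

word : ∀ {v} (m : Vec ℕ v) → Vec (Fin v) (sum m)
word []      = []
word (e ∷ m) = replicate e fz ++ᵥ Vec.map fs (word m)

η-word : ∀ {v} (m : Vec ℕ v) → η (word m) ≡ m
η-word []      = refl
η-word (e ∷ m) = prefix e (trans (η-shift (word m)) (cong (0 ∷_) (η-word m)))
  where
  η-shift : ∀ {v k} (t : Vec (Fin v) k) → η (Vec.map fs t) ≡ 0 ∷ η t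
  η-shift []      = refl
  η-shift (a ∷ t) = trans (η-cons (fs a) (Vec.map fs t))
                          (trans (cong (mulVar (fs a)) (η-shift t)) (cong (0 ∷_) (sym (η-cons a t))))
  prefix : ∀ {v k} e {t : Vec (Fin (suc v)) k} {r : Vec ℕ v} → η t ≡ 0 ∷ r → η (replicate e fz ++ᵥ t) ≡ e ∷ r
  prefix zero    p = p
  prefix (suc e) {t} p = trans (η-cons fz (replicate e fz ++ᵥ t)) (cong (mulVar fz) (prefix e p))

-- the canonical tuple of length n over a monomial of degree n
canon : ∀ {v} → Fin v → (n : ℕ) → Vec ℕ v → Vec (Fin v) n
canon a₀ n m with sum m ≟ℕ n
... | yes p = subst (Vec (Fin _)) p (word m)
... | no  _ = replicate n a₀

η-canon : ∀ {v} (a₀ : Fin v) {n} (m : Vec ℕ v) → sum m ≡ n → η (canon a₀ n m) ≡ m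
η-canon a₀ {n} m deg with sum m ≟ℕ n
... | yes refl = η-word m
... | no  ¬deg = ⊥-elim (¬deg deg)

canon-test : ∀ {v k} (a₀ : Fin v) (m : Vec ℕ v) (x : Vec (Fin v) k) → sum m ≡ k →
             ⌊ x ≟T canon a₀ k m ⌋ ≡ ⌊ x ≟T canon a₀ k (η x) ⌋ ∧ ⌊ m ≟M η x ⌋
canon-test a₀ m x deg with m ≟M η x
... | yes refl = sym (∧-identityʳ _)
... | no  m≢ηx = trans (⌊⌋-no (x ≟T canon a₀ _ m) (λ x≡ → m≢ηx (trans (sym (η-canon a₀ m deg)) (cong η (sym x≡)))))
                       (sym (∧-zeroʳ _))

module _ {v : ℕ} (adj : Fin v → Fin v → Bool) where

  powAdj-sym : SymmetricAdj adj → ∀ {k} (x y : Vec (Fin v) k) → powAdj adj x y ≡ powAdj adj y x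
  powAdj-sym sym-adj []       []       = refl
  powAdj-sym sym-adj (a ∷ x) (b ∷ y) =
    cong₂ _∨_ (cong₂ _∧_ (sym-adj a b) (⌊⌋-⇔ (x ≟T y) (y ≟T x) sym sym))
              (cong₂ _∧_ (⌊⌋-⇔ (a ≟F b) (b ≟F a) sym sym) (powAdj-sym sym-adj x y))

  powAdj-head : ∀ {k} {a b : Fin v} (t : Vec (Fin v) k) → adj a b ≡ true → powAdj adj (a ∷ t) (b ∷ t) ≡ true
  powAdj-head {a = a} {b} t ab = cong₂ (λ p q → (p ∧ q) ∨ (⌊ a ≟F b ⌋ ∧ powAdj adj t t)) ab (⌊⌋-yes (t ≟T t) refl)

  powAdj-tail : ∀ {k} (a : Fin v) {x y : Vec (Fin v) k} → powAdj adj x y ≡ true → powAdj adj (a ∷ x) (a ∷ y) ≡ true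
  powAdj-tail a xy = trans (cong₂ (λ p q → (adj a a ∧ _) ∨ (p ∧ q)) (⌊⌋-yes (a ≟F a) refl) xy) (∨-zeroʳ _)

  powAdj-update : ∀ {k} (t : Vec (Fin v) k) (q : Fin k) {u u' : Fin v} → adj u u' ≡ true →
                  powAdj adj (t [ q ]≔ u) (t [ q ]≔ u') ≡ true
  powAdj-update (a ∷ t) fz     uu' = powAdj-head t uu'
  powAdj-update (a ∷ t) (fs q) uu' = powAdj-tail a (powAdj-update t q uu')

-- A list L of (oriented) edges represents the element of the edge space
-- given by the F₂-sum of its edges; its indicator is  chain L, and its
-- boundary is  ends L.

module Chains {X : Set} (_≟_ : DecidableEquality X) where

  arc : X → X → EdgeFn X
  arc p q x y = ⌊ x ≟ p ⌋ ∧ ⌊ y ≟ q ⌋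

  chain : List (X × X) → EdgeFn X
  chain L x y = xorSum L (λ e → arc (proj₁ e) (proj₂ e) x y xor arc (proj₂ e) (proj₁ e) x y)

  -- z is an end of e (counted in F₂, so 0 for a loop)
  endpoint : X → X × X → Bool
  endpoint z e = ⌊ z ≟ proj₁ e ⌋ xor ⌊ z ≟ proj₂ e ⌋

  ends : List (X × X) → X → Bool
  ends L z = xorSum L (endpoint z)

  chain-sym : (L : List (X × X)) (x y : X) → chain L x y ≡ chain L y x
  chain-sym L x y = xorSum-cong L (λ e → trans (xor-comm (arc (proj₁ e) (proj₂ e) x y) _)
                                          (cong₂ _xor_ (∧-comm ⌊ x ≟ proj₂ e ⌋ _) (∧-comm ⌊ x ≟ proj₁ e ⌋ _)))

  chain-support : (R : X → X → Bool) → (∀ x y → R x y ≡ R y x) → (L : List (X × X)) →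
                  All (λ e → R (proj₁ e) (proj₂ e) ≡ true) L →
                  ∀ x y → chain L x y ≡ true → R x y ≡ true
  chain-support R R-sym L all x y e = from-edge (xorSum-witness L _ all e)
    where
    from-edge : Σ (X × X) (λ e → R (proj₁ e) (proj₂ e) ≡ true ×
                                 (arc (proj₁ e) (proj₂ e) x y xor arc (proj₂ e) (proj₁ e) x y) ≡ true) →
                R x y ≡ true
    from-edge ((p , q) , pq , hit) with xor-true hit
    ... | inj₁ forward  = let x≡p , y≡q = ∧-true forward in
      subst₂ (λ a b → R a b ≡ true) (sym (⌊⌋-sound (x ≟ p) x≡p)) (sym (⌊⌋-sound (y ≟ q) y≡q)) pq
    ... | inj₂ backward = let x≡q , y≡p = ∧-true backward in
      subst₂ (λ a b → R a b ≡ true) (sym (⌊⌋-sound (x ≟ q) x≡q)) (sym (⌊⌋-sound (y ≟ p) y≡p)) (trans (R-sym q p) pq)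

  module _ (vs : List X) (once : ∀ y → OnceIn _≟_ vs y) where

    arc-boundary : (p q x : X) → xorSum vs (arc p q x) ≡ ⌊ x ≟ p ⌋
    arc-boundary p q x = xorSum-sift _≟_ vs (λ _ → ⌊ x ≟ p ⌋) q (once q)

    chain-boundary : (L : List (X × X)) (x : X) → xorSum vs (chain L x) ≡ ends L x
    chain-boundary L x = trans (sym (xorSum-swap L vs (λ e → both e x)))
      (xorSum-cong L (λ e → trans (xorSum-xor vs (arc (proj₁ e) (proj₂ e) x) (arc (proj₂ e) (proj₁ e) x))
                                  (cong₂ _xor_ (arc-boundary (proj₁ e) (proj₂ e) x) (arc-boundary (proj₂ e) (proj₁ e) x))))
      where
      both : X × X → EdgeFn X
      both e x y = arc (proj₁ e) (proj₂ e) x y xor arc (proj₂ e) (proj₁ e) x y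

    pairing : (K₁ K₂ : X → Bool) → EdgeFn X → Bool
    pairing K₁ K₂ c = xorSum vs (λ x → xorSum vs (λ y → K₁ x ∧ (K₂ y ∧ c x y)))

    pairing-arc : (K₁ K₂ : X → Bool) (p q : X) → pairing K₁ K₂ (arc p q) ≡ K₁ p ∧ K₂ q
    pairing-arc K₁ K₂ p q = begin
      pairing K₁ K₂ (arc p q)
        ≡⟨ xorSum-cong vs (λ x → xorSum-cong vs (λ y → ∧-interchange (K₁ x) (K₂ y) _ _)) ⟩
      xorSum vs (λ x → xorSum vs (λ y → (K₁ x ∧ ⌊ x ≟ p ⌋) ∧ (K₂ y ∧ ⌊ y ≟ q ⌋)))
        ≡⟨ xorSum-cong vs (λ x → trans (xorSum-∧ˡ vs (K₁ x ∧ ⌊ x ≟ p ⌋) _) (cong ((K₁ x ∧ ⌊ x ≟ p ⌋) ∧_)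
                                        (xorSum-sift _≟_ vs K₂ q (once q)))) ⟩
      xorSum vs (λ x → (K₁ x ∧ ⌊ x ≟ p ⌋) ∧ K₂ q)
        ≡⟨ trans (xorSum-∧ʳ vs (K₂ q) (λ x → K₁ x ∧ ⌊ x ≟ p ⌋)) (cong (_∧ K₂ q) (xorSum-sift _≟_ vs K₁ p (once p))) ⟩
      K₁ p ∧ K₂ q ∎

    pairing-linear : {I : Set} (is : List I) (w : I → Bool) (g : I → EdgeFn X) (K₁ K₂ : X → Bool) →
                     pairing K₁ K₂ (λ x y → xorSum is (λ i → w i ∧ g i x y)) ≡ xorSum is (λ i → w i ∧ pairing K₁ K₂ (g i))
    pairing-linear {I} is w g K₁ K₂ = begin
      pairing K₁ K₂ (λ x y → xorSum is (λ i → w i ∧ g i x y))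
        ≡⟨ xorSum-cong vs (λ x → xorSum-cong vs (λ y → pull (K₁ x) (K₂ y) (λ i → g i x y))) ⟩
      xorSum vs (λ x → xorSum vs (λ y → xorSum is (λ i → w i ∧ (K₁ x ∧ (K₂ y ∧ g i x y)))))
        ≡⟨ xorSum-cong vs (λ x → xorSum-linear is vs w (λ i y → K₁ x ∧ (K₂ y ∧ g i x y))) ⟩
      xorSum vs (λ x → xorSum is (λ i → w i ∧ xorSum vs (λ y → K₁ x ∧ (K₂ y ∧ g i x y))))
        ≡⟨ xorSum-linear is vs w (λ i x → xorSum vs (λ y → K₁ x ∧ (K₂ y ∧ g i x y))) ⟩
      xorSum is (λ i → w i ∧ pairing K₁ K₂ (g i)) ∎
      where
      pull : ∀ a b (h : I → Bool) → a ∧ (b ∧ xorSum is (λ i → w i ∧ h i)) ≡ xorSum is (λ i → w i ∧ (a ∧ (b ∧ h i)))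
      pull a b h = begin
        a ∧ (b ∧ xorSum is (λ i → w i ∧ h i))     ≡⟨ cong (a ∧_) (sym (xorSum-∧ˡ is b _)) ⟩
        a ∧ xorSum is (λ i → b ∧ (w i ∧ h i))     ≡⟨ sym (xorSum-∧ˡ is a _) ⟩
        xorSum is (λ i → a ∧ (b ∧ (w i ∧ h i)))   ≡⟨ xorSum-cong is (λ i → trans (cong (a ∧_) (∧-exchange b (w i) _)) (∧-exchange a (w i) _)) ⟩
        xorSum is (λ i → w i ∧ (a ∧ (b ∧ h i)))   ∎

    pairing-xor : (K₁ K₂ : X → Bool) (c c' : EdgeFn X) →
                  pairing K₁ K₂ (λ x y → c x y xor c' x y) ≡ pairing K₁ K₂ c xor pairing K₁ K₂ c'
    pairing-xor K₁ K₂ c c' = begin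
      pairing K₁ K₂ (λ x y → c x y xor c' x y)
        ≡⟨ xorSum-cong vs (λ x → xorSum-cong vs (λ y → distrib (K₁ x) (K₂ y) (c x y) (c' x y))) ⟩
      xorSum vs (λ x → xorSum vs (λ y → K₁ x ∧ (K₂ y ∧ c x y) xor K₁ x ∧ (K₂ y ∧ c' x y)))
        ≡⟨ xorSum-cong vs (λ x → xorSum-xor vs (λ y → K₁ x ∧ (K₂ y ∧ c x y)) (λ y → K₁ x ∧ (K₂ y ∧ c' x y))) ⟩
      xorSum vs (λ x → xorSum vs (λ y → K₁ x ∧ (K₂ y ∧ c x y)) xor xorSum vs (λ y → K₁ x ∧ (K₂ y ∧ c' x y)))
        ≡⟨ xorSum-xor vs (λ x → xorSum vs (λ y → K₁ x ∧ (K₂ y ∧ c x y))) (λ x → xorSum vs (λ y → K₁ x ∧ (K₂ y ∧ c' x y))) ⟩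
      pairing K₁ K₂ c xor pairing K₁ K₂ c' ∎
      where
      distrib : ∀ a b p q → a ∧ (b ∧ (p xor q)) ≡ a ∧ (b ∧ p) xor a ∧ (b ∧ q)
      distrib a b p q = trans (cong (a ∧_) (∧-distribˡ-xor b p q)) (∧-distribˡ-xor a _ _)

    pairing-chain : (K₁ K₂ : X → Bool) (L : List (X × X)) →
                    pairing K₁ K₂ (chain L) ≡ xorSum L (λ e → (K₁ (proj₁ e) ∧ K₂ (proj₂ e)) xor (K₁ (proj₂ e) ∧ K₂ (proj₁ e)))
    pairing-chain K₁ K₂ L =
      trans (pairing-linear L (λ _ → true) (λ e x y → arc (proj₁ e) (proj₂ e) x y xor arc (proj₂ e) (proj₁ e) x y) K₁ K₂)
            (xorSum-cong L (λ e → trans (pairing-xor K₁ K₂ (arc (proj₁ e) (proj₂ e)) (arc (proj₂ e) (proj₁ e)))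
                                        (cong₂ _xor_ (pairing-arc K₁ K₂ (proj₁ e) (proj₂ e)) (pairing-arc K₁ K₂ (proj₂ e) (proj₁ e)))))

-- A null chain from x to y is a list of edges of G^k with boundary x + y
-- whose image under η cancels: for every F, the F-values of the η-images
-- of its edges sum to 0.  When η x = η y such a chain exists (G connected).

module NullChains {v : ℕ} (adj : Fin v → Fin v → Bool) (connected : Connected adj) where

  open Chains

  image : ∀ {k} → (Vec ℕ v → Vec ℕ v → Bool) → List (Vec (Fin v) k × Vec (Fin v) k) → Bool
  image F L = xorSum L (λ e → F (η (proj₁ e)) (η (proj₂ e)))

  record NullChain {k : ℕ} (x y : Vec (Fin v) k) : Set where
    field
      edges          : List (Vec (Fin v) k × Vec (Fin v) k)
      edges-adjacent : All (λ e → powAdj adj (proj₁ e) (proj₂ e) ≡ true) edges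
      edges-ends     : ∀ z → ends _≟T_ edges z ≡ ⌊ z ≟T x ⌋ xor ⌊ z ≟T y ⌋
      image-cancels  : ∀ F → image F edges ≡ false
  open NullChain

  null-refl : ∀ {k} (x : Vec (Fin v) k) → NullChain x x
  null-refl x = record
    { edges = [] ; edges-adjacent = [] ; edges-ends = λ z → sym (xor-same ⌊ z ≟T x ⌋) ; image-cancels = λ _ → refl }

  null-sym : ∀ {k} {x y : Vec (Fin v) k} → NullChain x y → NullChain y x
  null-sym {x = x} {y} N = record
    { edges = edges N ; edges-adjacent = edges-adjacent N ; image-cancels = image-cancels N
    ; edges-ends = λ z → trans (edges-ends N z) (xor-comm ⌊ z ≟T x ⌋ _) }

  null-trans : ∀ {k} {x y z : Vec (Fin v) k} → NullChain x y → NullChain y z → NullChain x z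
  null-trans {x = x} {y} {z} M N = record
    { edges          = edges M ++ edges N
    ; edges-adjacent = All.++⁺ (edges-adjacent M) (edges-adjacent N)
    ; edges-ends     = λ u → trans (xorSum-++ (edges M) (edges N) (endpoint _≟T_ u))
                               (trans (cong₂ _xor_ (edges-ends M u) (edges-ends N u))
                                      (xor-cancel-middle ⌊ u ≟T x ⌋ ⌊ u ≟T y ⌋ ⌊ u ≟T z ⌋))
    ; image-cancels  = λ F → trans (xorSum-++ (edges M) (edges N) (λ e → F (η (proj₁ e)) (η (proj₂ e)))) (cong₂ _xor_ (image-cancels M F) (image-cancels N F))
    }

  cons-test : ∀ {k} (b a : Fin v) (z x : Vec (Fin v) k) → ⌊ (b ∷ z) ≟T (a ∷ x) ⌋ ≡ ⌊ b ≟F a ⌋ ∧ ⌊ z ≟T x ⌋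
  cons-test b a z x = ⌊⌋-× (b ≟F a) (z ≟T x) ((b ∷ z) ≟T (a ∷ x)) (cong₂ _∷_) ∷-injective

  null-cons : ∀ {k} (a : Fin v) {x y : Vec (Fin v) k} → NullChain x y → NullChain (a ∷ x) (a ∷ y)
  null-cons {k} a {x} {y} N = record
    { edges          = map prefix (edges N)
    ; edges-adjacent = All.map⁺ (All.map (powAdj-tail adj a) (edges-adjacent N))
    ; edges-ends     = ends-cons
    ; image-cancels  = λ F → trans (xorSum-map (edges N) prefix (λ e → F (η (proj₁ e)) (η (proj₂ e))))
                                   (trans (xorSum-cong (edges N) (λ e → cong₂ F (η-cons a (proj₁ e)) (η-cons a (proj₂ e))))
                                          (image-cancels N (λ m m' → F (mulVar a m) (mulVar a m'))))
    }
    where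
    prefix : Vec (Fin v) k × Vec (Fin v) k → Vec (Fin v) (suc k) × Vec (Fin v) (suc k)
    prefix e = a ∷ proj₁ e , a ∷ proj₂ e
    ends-cons : ∀ z → ends _≟T_ (map prefix (edges N)) z ≡ ⌊ z ≟T (a ∷ x) ⌋ xor ⌊ z ≟T (a ∷ y) ⌋
    ends-cons (b ∷ z) = begin
      ends _≟T_ (map prefix (edges N)) (b ∷ z)
        ≡⟨ xorSum-map (edges N) prefix (endpoint _≟T_ (b ∷ z)) ⟩
      xorSum (edges N) (λ e → ⌊ (b ∷ z) ≟T (a ∷ proj₁ e) ⌋ xor ⌊ (b ∷ z) ≟T (a ∷ proj₂ e) ⌋)
        ≡⟨ xorSum-cong (edges N) (λ e → trans (cong₂ _xor_ (cons-test b a z (proj₁ e)) (cons-test b a z (proj₂ e)))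
                                              (sym (∧-distribˡ-xor ⌊ b ≟F a ⌋ _ _))) ⟩
      xorSum (edges N) (λ e → ⌊ b ≟F a ⌋ ∧ endpoint _≟T_ z e)
        ≡⟨ xorSum-∧ˡ (edges N) ⌊ b ≟F a ⌋ (endpoint _≟T_ z) ⟩
      ⌊ b ≟F a ⌋ ∧ ends _≟T_ (edges N) z
        ≡⟨ cong (⌊ b ≟F a ⌋ ∧_) (edges-ends N z) ⟩
      ⌊ b ≟F a ⌋ ∧ (⌊ z ≟T x ⌋ xor ⌊ z ≟T y ⌋)
        ≡⟨ ∧-distribˡ-xor ⌊ b ≟F a ⌋ _ _ ⟩
      ⌊ b ≟F a ⌋ ∧ ⌊ z ≟T x ⌋ xor ⌊ b ≟F a ⌋ ∧ ⌊ z ≟T y ⌋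
        ≡⟨ sym (cong₂ _xor_ (cons-test b a z x) (cons-test b a z y)) ⟩
      ⌊ (b ∷ z) ≟T (a ∷ x) ⌋ xor ⌊ (b ∷ z) ≟T (a ∷ y) ⌋ ∎

  walk-edges : ∀ {b a} → Reach adj b a → List (Fin v × Fin v)
  walk-edges here               = []
  walk-edges (step {x} {y} _ r) = (x , y) ∷ walk-edges r

  walk-adjacent : ∀ {b a} (r : Reach adj b a) → All (λ s → adj (proj₁ s) (proj₂ s) ≡ true) (walk-edges r)
  walk-adjacent here         = []
  walk-adjacent (step xy r) = xy ∷ walk-adjacent r

  along : ∀ {k b a} → (Fin v → Vec (Fin v) k) → Reach adj b a → List (Vec (Fin v) k × Vec (Fin v) k)
  along g r = map (λ s → g (proj₁ s) , g (proj₂ s)) (walk-edges r)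

  along-ends : ∀ {k b a} (g : Fin v → Vec (Fin v) k) (r : Reach adj b a) (z : Vec (Fin v) k) →
               ends _≟T_ (along g r) z ≡ ⌊ z ≟T g b ⌋ xor ⌊ z ≟T g a ⌋
  along-ends {b = b} g here       z = sym (xor-same ⌊ z ≟T g b ⌋)
  along-ends {b = b} {a} g (step {y = y} _ r) z =
    trans (cong ((⌊ z ≟T g b ⌋ xor ⌊ z ≟T g y ⌋) xor_) (along-ends g r z))
          (xor-cancel-middle ⌊ z ≟T g b ⌋ ⌊ z ≟T g y ⌋ ⌊ z ≟T g a ⌋)

  along-image : ∀ {k b a} (g : Fin v → Vec (Fin v) k) (r : Reach adj b a) F →
                image F (along g r) ≡ xorSum (walk-edges r) (λ s → F (η (g (proj₁ s))) (η (g (proj₂ s))))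
  along-image g r F = xorSum-map (walk-edges r) (λ s → g (proj₁ s) , g (proj₂ s)) (λ e → F (η (proj₁ e)) (η (proj₂ e)))

  -- the basic null chain: if y_q = a, then b ∷ y and a ∷ (y with y_q := b) lie
  -- over the same monomial; walk the first coordinate from b to a, and the
  -- q-th from b to a; corresponding edges of the two walks have equal images
  null-swap : ∀ {k} (b : Fin v) (y : Vec (Fin v) k) (q : Fin k) {a : Fin v} → lookup y q ≡ a →
              NullChain (b ∷ y) (a ∷ (y [ q ]≔ b))
  null-swap {k} b y q {a} yq≡a = record
    { edges          = along first r ++ along other r
    ; edges-adjacent = All.++⁺ (All.map⁺ (All.map (powAdj-head adj y) (walk-adjacent r)))
                               (All.map⁺ (All.map (powAdj-tail adj a ∘ powAdj-update adj y q) (walk-adjacent r)))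
    ; edges-ends     = swap-ends
    ; image-cancels  = λ F → begin
        image F (along first r ++ along other r)
          ≡⟨ xorSum-++ (along first r) (along other r) (λ e → F (η (proj₁ e)) (η (proj₂ e))) ⟩
        image F (along first r) xor image F (along other r)
          ≡⟨ cong₂ _xor_ (along-image first r F) (along-image other r F) ⟩
        xorSum (walk-edges r) (λ s → F (η (first (proj₁ s))) (η (first (proj₂ s))))
          xor xorSum (walk-edges r) (λ s → F (η (other (proj₁ s))) (η (other (proj₂ s))))
          ≡⟨ cong (_xor xorSum (walk-edges r) (λ s → F (η (other (proj₁ s))) (η (other (proj₂ s)))))
                  (xorSum-cong (walk-edges r) (λ s → cong₂ F (same-image (proj₁ s)) (same-image (proj₂ s)))) ⟩
        xorSum (walk-edges r) (λ s → F (η (other (proj₁ s))) (η (other (proj₂ s))))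
          xor xorSum (walk-edges r) (λ s → F (η (other (proj₁ s))) (η (other (proj₂ s))))
          ≡⟨ xor-same (xorSum (walk-edges r) (λ s → F (η (other (proj₁ s))) (η (other (proj₂ s))))) ⟩
        false ∎
    }
    where
    r : Reach adj b a
    r = connected b a
    first other : Fin v → Vec (Fin v) (suc k)
    first u = u ∷ y
    other u = a ∷ (y [ q ]≔ u)
    same-image : ∀ u → η (first u) ≡ η (other u)
    same-image u = trans (η-cons u y) (trans (sym (η-replace y q u yq≡a)) (sym (η-cons a (y [ q ]≔ u))))
    meet : first a ≡ other a
    meet = cong (a ∷_) (sym (trans (cong (y [ q ]≔_) (sym yq≡a)) ([]≔-lookup y q)))
    swap-ends : ∀ z → ends _≟T_ (along first r ++ along other r) z ≡ ⌊ z ≟T (b ∷ y) ⌋ xor ⌊ z ≟T other b ⌋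
    swap-ends z = begin
      ends _≟T_ (along first r ++ along other r) z
        ≡⟨ xorSum-++ (along first r) (along other r) (endpoint _≟T_ z) ⟩
      ends _≟T_ (along first r) z xor ends _≟T_ (along other r) z
        ≡⟨ cong₂ _xor_ (along-ends first r z) (along-ends other r z) ⟩
      (⌊ z ≟T first b ⌋ xor ⌊ z ≟T first a ⌋) xor (⌊ z ≟T other b ⌋ xor ⌊ z ≟T other a ⌋)
        ≡⟨ cong (λ w → (⌊ z ≟T first b ⌋ xor ⌊ z ≟T w ⌋) xor (⌊ z ≟T other b ⌋ xor ⌊ z ≟T other a ⌋)) meet ⟩
      (⌊ z ≟T first b ⌋ xor ⌊ z ≟T other a ⌋) xor (⌊ z ≟T other b ⌋ xor ⌊ z ≟T other a ⌋)
        ≡⟨ cong ((⌊ z ≟T first b ⌋ xor ⌊ z ≟T other a ⌋) xor_) (xor-comm ⌊ z ≟T other b ⌋ _) ⟩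
      (⌊ z ≟T first b ⌋ xor ⌊ z ≟T other a ⌋) xor (⌊ z ≟T other a ⌋ xor ⌊ z ≟T other b ⌋)
        ≡⟨ xor-cancel-middle ⌊ z ≟T first b ⌋ _ _ ⟩
      ⌊ z ≟T (b ∷ y) ⌋ xor ⌊ z ≟T other b ⌋ ∎

  null-chain : ∀ {k} (x y : Vec (Fin v) k) → η x ≡ η y → NullChain x y
  null-chain []      []      _ = null-refl []
  null-chain (a ∷ x) (b ∷ y) e with a ≟F b
  ... | yes refl = null-cons a (null-chain x y (η-cancel a x y e))
  ... | no  a≢b  = null-trans (null-cons a (null-chain x (y [ q ]≔ b) (η-cancel a x (y [ q ]≔ b) (trans e swapped))))
                              (null-sym (null-swap b y q yq≡a))
    where
    q : Fin _
    q = proj₁ (occurs-in-other x y a≢b e)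
    yq≡a : lookup y q ≡ a
    yq≡a = proj₂ (occurs-in-other x y a≢b e)
    swapped : η (b ∷ y) ≡ η (a ∷ (y [ q ]≔ b))
    swapped = trans (η-cons b y) (trans (sym (η-replace y q b yq≡a)) (sym (η-cons a (y [ q ]≔ b))))

-- A triple (i , j , f) with f ∈ M_k stands for the oriented pair
-- a_i f → a_j f.  If a_i a_j is an edge of G this is an arc of G^(k+1), and
-- (G being loopless) every arc of G^(k+1) comes from exactly one triple.

Triple : ℕ → Set
Triple v = Fin v × Fin v × Vec ℕ v

_≟3_ : ∀ {v} → DecidableEquality (Triple v)
_≟3_ = ×-≡-dec _≟F_ (×-≡-dec _≟F_ _≟M_)

module _ {v : ℕ} where

  source target : Triple v → Vec ℕ v
  source (i , j , f) = mulVar i f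
  target (i , j , f) = mulVar j f

  reverse : Triple v → Triple v
  reverse (i , j , f) = j , i , f

  triples : ℕ → List (Triple v)
  triples k = concatMap (λ i → map (i ,_) (concatMap (λ j → map (j ,_) (monos v k)) (allFin v))) (allFin v)

  xorSum-triples : ∀ k (g : Triple v → Bool) →
                   xorSum (triples k) g ≡ xorSum (allFin v) (λ i → xorSum (allFin v) (λ j → xorSum (monos v k) (λ f → g (i , j , f))))
  xorSum-triples k g =
    trans (xorSum-concatMap (allFin v) _ g)
          (xorSum-cong (allFin v) (λ i →
            trans (xorSum-map (concatMap (λ j → map (j ,_) (monos v k)) (allFin v)) (i ,_) g)
                  (trans (xorSum-concatMap (allFin v) _ (g ∘ (i ,_)))
                         (xorSum-cong (allFin v) (λ j → xorSum-map (monos v k) (j ,_) (g ∘ (i ,_)))))))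

  xorSum-reverse : ∀ k (g : Triple v → Bool) → xorSum (triples k) (g ∘ reverse) ≡ xorSum (triples k) g
  xorSum-reverse k g = begin
    xorSum (triples k) (g ∘ reverse)
      ≡⟨ xorSum-triples k (g ∘ reverse) ⟩
    xorSum (allFin v) (λ i → xorSum (allFin v) (λ j → xorSum (monos v k) (λ f → g (j , i , f))))
      ≡⟨ xorSum-swap (allFin v) (allFin v) (λ i j → xorSum (monos v k) (λ f → g (j , i , f))) ⟩
    xorSum (allFin v) (λ j → xorSum (allFin v) (λ i → xorSum (monos v k) (λ f → g (j , i , f))))
      ≡⟨ sym (xorSum-triples k g) ⟩
    xorSum (triples k) g ∎

  triples-degree : ∀ k → All (λ t → sum (proj₂ (proj₂ t)) ≡ k) (triples k)
  triples-degree k = All.concat⁺ (All.map⁺ (All.universal (λ i → All.map⁺ {f = i ,_} inner) (allFin v)))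
    where
    inner : All (λ t → sum (proj₂ t) ≡ k) (concatMap (λ j → map (j ,_) (monos v k)) (allFin v))
    inner = All.concat⁺ (All.map⁺ (All.universal (λ j → All.map⁺ (monos-degree v k)) (allFin v)))

  once-triples : ∀ k (i j : Fin v) (f : Vec ℕ v) → sum f ≡ k → OnceIn _≟3_ (triples k) (i , j , f)
  once-triples k i j f deg =
    once-concatMap _≟F_ (×-≡-dec _≟F_ _≟M_) _≟3_ _,_ ,-injective (allFin v) _ (once-allFin v i)
      (once-concatMap _≟F_ _≟M_ (×-≡-dec _≟F_ _≟M_) _,_ ,-injective (allFin v) _ (once-allFin v j)
        (once-monos v k f deg))

  arc-unique : ∀ {i j i' j' : Fin v} {f f' : Vec ℕ v} → i ≢ j →
               mulVar i f ≡ mulVar i' f' → mulVar j f ≡ mulVar j' f' → (i , j , f) ≡ (i' , j' , f')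
  arc-unique {i} {j} {i'} {j'} {f} {f'} i≢j src tgt = cong₂ _,_ i≡i' (cong₂ _,_ j≡j' f≡f')
    where
    i≡i' : i ≡ i'
    i≡i' with i ≟F i'
    ... | yes i≡i' = i≡i'
    ... | no  i≢i' = ⊥-elim (differ (j' ≟F i))
      where
      -- compare the exponents of a_i in the two sources and the two targets
      at-source : suc (lookup f i) ≡ lookup f' i
      at-source = trans (sym (mulVar-here i f)) (trans (cong (λ m → lookup m i) src) (mulVar-elsewhere f' (i≢i' ∘ sym)))
      at-target : lookup f i ≡ lookup (mulVar j' f') i
      at-target = trans (sym (mulVar-elsewhere f (i≢j ∘ sym))) (cong (λ m → lookup m i) tgt)
      differ : Dec (j' ≡ i) → ⊥
      differ (yes refl) = m≢1+n+m (lookup f i) {1} (trans at-target (trans (mulVar-here j' f') (cong suc (sym at-source))))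
      differ (no  j'≢i) = 1+n≢n (sym (trans at-target (trans (mulVar-elsewhere f' j'≢i) (sym at-source))))
    f≡f' : f ≡ f'
    f≡f' = mulVar-injective i' (subst (λ a → mulVar a f ≡ mulVar i' f') i≡i' src)
    j≡j' : j ≡ j'
    j≡j' = mulVar-injectiveˡ f' (subst (λ g → mulVar j g ≡ mulVar j' f') f≡f' tgt)

module ArcDecomposition {v : ℕ} (adj : Fin v → Fin v → Bool) (loopless : IrreflexiveAdj adj) (k : ℕ) where

  represents : Vec ℕ v → Vec ℕ v → Triple v → Bool
  represents m m' t@(i , j , f) = adj i j ∧ (⌊ source t ≟M m ⌋ ∧ ⌊ target t ≟M m' ⌋)

  adjacent-represented : ∀ m m' → redAdj adj (suc k) m m' ≡ true →
                         Σ (Triple v) (λ t → sum (proj₂ (proj₂ t)) ≡ k × represents m m' t ≡ true)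
  adjacent-represented m m' e = (i , j , f) , deg , cong₂ _∧_ a (cong₂ _∧_ (flip m s) (flip m' t))
    where
    hit : Fin v → Fin v → Vec ℕ v → Bool
    hit i j f = adj i j ∧ (m ==M mulVar i f) ∧ (m' ==M mulVar j f)
    everywhere : All (λ _ → ⊤) (allFin v)
    everywhere = All.universal (λ _ → tt) (allFin v)
    witness-i = any-witness (allFin v) (λ i → any (λ j → any (hit i j) (monos v k)) (allFin v)) everywhere e
    i = proj₁ witness-i
    witness-j = any-witness (allFin v) (λ j → any (hit i j) (monos v k)) everywhere (proj₂ (proj₂ witness-i))
    j = proj₁ witness-j
    witness-f = any-witness (monos v k) (hit i j) (monos-degree v k) (proj₂ (proj₂ witness-j))
    f = proj₁ witness-f
    deg = proj₁ (proj₂ witness-f)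
    parts = ∧-true {adj i j} (proj₂ (proj₂ witness-f))
    a = proj₁ parts
    s = proj₁ (∧-true {m ==M mulVar i f} (proj₂ parts))
    t = proj₂ (∧-true {m ==M mulVar i f} (proj₂ parts))
    flip : ∀ {n} (n₀ : Vec ℕ v) → (n₀ ==M n) ≡ true → (n ==M n₀) ≡ true
    flip {n} n₀ eq = trans (⌊⌋-⇔ (n ≟M n₀) (n₀ ≟M n) sym sym) eq

  represented-once : ∀ m m' → redAdj adj (suc k) m m' ≡ true → xorSum (triples k) (represents m m') ≡ true
  represented-once m m' e =
    trans (xorSum-single _≟3_ (triples k) (represents m m') t₀ (once-triples k i₀ j₀ f₀ deg) unique) r₀
    where
    rep = adjacent-represented m m' e
    t₀ = proj₁ rep
    i₀ = proj₁ t₀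
    j₀ = proj₁ (proj₂ t₀)
    f₀ = proj₂ (proj₂ t₀)
    deg = proj₁ (proj₂ rep)
    r₀ = proj₂ (proj₂ rep)
    arc-equations : ∀ t → represents m m' t ≡ true →
                    (adj (proj₁ t) (proj₁ (proj₂ t)) ≡ true) × (source t ≡ m) × (target t ≡ m')
    arc-equations t r = let a , st = ∧-true {adj (proj₁ t) (proj₁ (proj₂ t))} r
                            s , tg = ∧-true {⌊ source t ≟M m ⌋} st in
      a , ⌊⌋-sound (source t ≟M m) s , ⌊⌋-sound (target t ≟M m') tg
    unique : ∀ t → represents m m' t ≡ true → t ≡ t₀
    unique t r =
      let a , s , tg = arc-equations t r ; _ , s₀ , tg₀ = arc-equations t₀ r₀ in
      arc-unique (λ { refl → true≢false (trans (sym a) (loopless (proj₁ t))) }) (trans s (sym s₀)) (trans tg (sym tg₀))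

  module _ (d : EdgeFn (Vec ℕ v)) (supported : ∀ m m' → d m m' ≡ true → redAdj adj (suc k) m m' ≡ true) where

    weight : Triple v → Bool
    weight t@(i , j , f) = adj i j ∧ d (source t) (target t)

    sum-of-arcs : ∀ m m' → xorSum (triples k) (λ t → weight t ∧ (⌊ source t ≟M m ⌋ ∧ ⌊ target t ≟M m' ⌋)) ≡ d m m'
    sum-of-arcs m m' = begin
      xorSum (triples k) (λ t → weight t ∧ (⌊ source t ≟M m ⌋ ∧ ⌊ target t ≟M m' ⌋))
        ≡⟨ xorSum-cong (triples k) (λ t → trans (∧-guard (source t ≟M m) (target t ≟M m') (λ s tg → cong (adj (proj₁ t) (proj₁ (proj₂ t)) ∧_) (cong₂ d s tg)))
                                                (∧-assoc-exchange (adj (proj₁ t) (proj₁ (proj₂ t))) (d m m') _)) ⟩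
      xorSum (triples k) (λ t → d m m' ∧ represents m m' t)
        ≡⟨ xorSum-∧ˡ (triples k) (d m m') (represents m m') ⟩
      d m m' ∧ xorSum (triples k) (represents m m')
        ≡⟨ all-represented ⟩
      d m m' ∎
      where
      all-represented : d m m' ∧ xorSum (triples k) (represents m m') ≡ d m m'
      all-represented with d m m' in dmm'
      ... | true  = represented-once m m' (supported m m' dmm')
      ... | false = refl

    no-loops : ∀ m → d m m ≡ false
    no-loops m with d m m in dmm
    ... | false = refl
    ... | true  =
      let (i , j , f) , _ , r = adjacent-represented m m (supported m m dmm)
          a , st = ∧-true {adj i j} r
          s , tg = ∧-true {⌊ mulVar i f ≟M m ⌋} st
          i≡j = mulVar-injectiveˡ f (trans (⌊⌋-sound (mulVar i f ≟M m) s) (sym (⌊⌋-sound (mulVar j f ≟M m) tg)))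
      in ⊥-elim (true≢false (trans (sym a) (trans (cong (λ x → adj i x) (sym i≡j)) (loopless i))))

-- The arc a_i f → a_j f is lifted to the oriented pair (i ∷ w_f , j ∷ w_f)
-- of G^{k+1}, where w_f is the canonical tuple over f, plus a null chain
-- (the detour) from i ∷ w_f to the canonical tuple over a_i f.  Summed over
-- y, the lifted arc at (x , y) is [x is canonical over a_i f], and its
-- η-image is the arc itself.  Weighting by d and summing over all triples,
-- the row sums vanish because d is a cycle, and the image is d.  The vertex
-- a₀ only pads canonical tuples of the wrong degree.

module Lift {v : ℕ} (adj : Fin v → Fin v → Bool) (sym-adj : SymmetricAdj adj) (loopless : IrreflexiveAdj adj)
            (connected : Connected adj) (a₀ : Fin v) (k : ℕ)
            (d : EdgeFn (Vec ℕ v)) (cycle : IsCycle (Red v adj (suc k)) d) where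

  open Chains (_≟T_ {v} {suc k})
  open NullChains adj connected
  open NullChain
  open ArcDecomposition adj loopless k

  Tuple : Set
  Tuple = Vec (Fin v) (suc k)

  tuples : List Tuple
  tuples = allTuples v (suc k)

  all-once : ∀ x → OnceIn _≟T_ tuples x
  all-once = once-allTuples v (suc k)

  d-sym : ∀ m m' → d m m' ≡ d m' m
  d-sym = proj₁ (proj₁ cycle)

  d-supported : ∀ m m' → d m m' ≡ true → redAdj adj (suc k) m m' ≡ true
  d-supported = proj₂ (proj₁ cycle)

  d-closed : ∀ m → xorSum (monos v (suc k)) (d m) ≡ false
  d-closed = proj₂ cycle

  w : Triple v → Bool
  w = weight d d-supported

  home : Vec ℕ v → Tuple
  home = canon a₀ (suc k)

  tail-lift head-lift : Triple v → Tuple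
  tail-lift (i , j , f) = i ∷ canon a₀ k f
  head-lift (i , j , f) = j ∷ canon a₀ k f

  degree : Triple v → ℕ
  degree t = sum (proj₂ (proj₂ t))

  η-tail-lift : ∀ t → degree t ≡ k → η (tail-lift t) ≡ source t
  η-tail-lift (i , j , f) deg = trans (η-cons i (canon a₀ k f)) (cong (mulVar i) (η-canon a₀ f deg))

  η-head-lift : ∀ t → degree t ≡ k → η (head-lift t) ≡ target t
  η-head-lift (i , j , f) deg = trans (η-cons j (canon a₀ k f)) (cong (mulVar j) (η-canon a₀ f deg))

  sum-source : ∀ t → degree t ≡ k → sum (source t) ≡ suc k
  sum-source (i , j , f) deg = trans (sum-mulVar i f) (cong suc deg)

  sum-target : ∀ t → degree t ≡ k → sum (target t) ≡ suc k
  sum-target (i , j , f) deg = trans (sum-mulVar j f) (cong suc deg)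

  detour-chain : ∀ t → degree t ≡ k → NullChain (tail-lift t) (home (source t))
  detour-chain t deg = null-chain (tail-lift t) (home (source t))
                         (trans (η-tail-lift t deg) (sym (η-canon a₀ (source t) (sum-source t deg))))

  detour-if : ∀ t → Dec (degree t ≡ k) → List (Tuple × Tuple)
  detour-if t (yes deg) = edges (detour-chain t deg)
  detour-if t (no  _)   = []

  detour : Triple v → List (Tuple × Tuple)
  detour t = detour-if t (degree t ≟ℕ k)

  detour-adjacent : ∀ t → All (λ e → powAdj adj (proj₁ e) (proj₂ e) ≡ true) (detour t)
  detour-adjacent t = adjacent-if (degree t ≟ℕ k)
    where
    adjacent-if : (deg? : Dec (degree t ≡ k)) → All (λ e → powAdj adj (proj₁ e) (proj₂ e) ≡ true) (detour-if t deg?)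
    adjacent-if (yes deg) = edges-adjacent (detour-chain t deg)
    adjacent-if (no  _)   = []

  detour-ends : ∀ t → degree t ≡ k → ∀ z → ends (detour t) z ≡ ⌊ z ≟T tail-lift t ⌋ xor ⌊ z ≟T home (source t) ⌋
  detour-ends t deg z = ends-if (degree t ≟ℕ k)
    where
    ends-if : (deg? : Dec (degree t ≡ k)) → ends (detour-if t deg?) z ≡ ⌊ z ≟T tail-lift t ⌋ xor ⌊ z ≟T home (source t) ⌋
    ends-if (yes deg′) = edges-ends (detour-chain t deg′) z
    ends-if (no  ¬deg) = ⊥-elim (¬deg deg)

  detour-image : ∀ t → degree t ≡ k → ∀ F → image F (detour t) ≡ false
  detour-image t deg F = image-if (degree t ≟ℕ k)
    where
    image-if : (deg? : Dec (degree t ≡ k)) → image F (detour-if t deg?) ≡ false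
    image-if (yes deg′) = image-cancels (detour-chain t deg′) F
    image-if (no  ¬deg) = ⊥-elim (¬deg deg)

  lift : Triple v → EdgeFn Tuple
  lift t x y = arc (tail-lift t) (head-lift t) x y xor chain (detour t) x y

  c : EdgeFn Tuple
  c x y = xorSum (triples k) (λ t → w t ∧ lift t x y)

  lift-boundary : ∀ t → degree t ≡ k → ∀ x → xorSum tuples (lift t x) ≡ ⌊ x ≟T home (source t) ⌋
  lift-boundary t deg x = begin
    xorSum tuples (lift t x)
      ≡⟨ xorSum-xor tuples (arc (tail-lift t) (head-lift t) x) (chain (detour t) x) ⟩
    xorSum tuples (arc (tail-lift t) (head-lift t) x) xor xorSum tuples (chain (detour t) x)
      ≡⟨ cong₂ _xor_ (arc-boundary tuples all-once (tail-lift t) (head-lift t) x)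
                     (trans (chain-boundary tuples all-once (detour t) x) (detour-ends t deg x)) ⟩
    ⌊ x ≟T tail-lift t ⌋ xor (⌊ x ≟T tail-lift t ⌋ xor ⌊ x ≟T home (source t) ⌋)
      ≡⟨ xor-cancelˡ ⌊ x ≟T tail-lift t ⌋ _ ⟩
    ⌊ x ≟T home (source t) ⌋ ∎

  over : Vec ℕ v → Tuple → Bool
  over m x = ⌊ η x ≟M m ⌋

  lift-image : ∀ t → degree t ≡ k → ∀ m m' →
               pairing tuples all-once (over m) (over m') (lift t) ≡ ⌊ source t ≟M m ⌋ ∧ ⌊ target t ≟M m' ⌋
  lift-image t deg m m' = begin
    pairing tuples all-once (over m) (over m') (lift t)
      ≡⟨ pairing-xor tuples all-once (over m) (over m') (arc (tail-lift t) (head-lift t)) (chain (detour t)) ⟩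
    pairing tuples all-once (over m) (over m') (arc (tail-lift t) (head-lift t))
      xor pairing tuples all-once (over m) (over m') (chain (detour t))
      ≡⟨ cong₂ _xor_ (pairing-arc tuples all-once (over m) (over m') (tail-lift t) (head-lift t))
                     (trans (pairing-chain tuples all-once (over m) (over m') (detour t))
                            (detour-image t deg (λ p q → (⌊ p ≟M m ⌋ ∧ ⌊ q ≟M m' ⌋) xor (⌊ q ≟M m ⌋ ∧ ⌊ p ≟M m' ⌋)))) ⟩
    (over m (tail-lift t) ∧ over m' (head-lift t)) xor false
      ≡⟨ xor-identityʳ _ ⟩
    over m (tail-lift t) ∧ over m' (head-lift t)
      ≡⟨ cong₂ (λ p q → ⌊ p ≟M m ⌋ ∧ ⌊ q ≟M m' ⌋) (η-tail-lift t deg) (η-head-lift t deg) ⟩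
    ⌊ source t ≟M m ⌋ ∧ ⌊ target t ≟M m' ⌋ ∎

  -- Σ_t w(t) [source t = m] is the boundary of d at m, hence 0
  weights-at-source : ∀ m → xorSum (triples k) (λ t → w t ∧ ⌊ source t ≟M m ⌋) ≡ false
  weights-at-source m = begin
    xorSum (triples k) (λ t → w t ∧ ⌊ source t ≟M m ⌋)
      ≡⟨ sym (xorSum-congᴬ (triples k) (triples-degree k) (λ t deg → cong (w t ∧_) (targets-once t deg))) ⟩
    xorSum (triples k) (λ t → w t ∧ xorSum (monos v (suc k)) (λ m' → ⌊ source t ≟M m ⌋ ∧ ⌊ target t ≟M m' ⌋))
      ≡⟨ sym (xorSum-linear (triples k) (monos v (suc k)) w (λ t m' → ⌊ source t ≟M m ⌋ ∧ ⌊ target t ≟M m' ⌋)) ⟩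
    xorSum (monos v (suc k)) (λ m' → xorSum (triples k) (λ t → w t ∧ (⌊ source t ≟M m ⌋ ∧ ⌊ target t ≟M m' ⌋)))
      ≡⟨ xorSum-cong (monos v (suc k)) (sum-of-arcs d d-supported m) ⟩
    xorSum (monos v (suc k)) (d m)
      ≡⟨ d-closed m ⟩
    false ∎
    where
    targets-once : ∀ t → degree t ≡ k → xorSum (monos v (suc k)) (λ m' → ⌊ source t ≟M m ⌋ ∧ ⌊ target t ≟M m' ⌋) ≡ ⌊ source t ≟M m ⌋
    targets-once t deg = begin
      xorSum (monos v (suc k)) (λ m' → ⌊ source t ≟M m ⌋ ∧ ⌊ target t ≟M m' ⌋)
        ≡⟨ xorSum-∧ˡ (monos v (suc k)) ⌊ source t ≟M m ⌋ (λ m' → ⌊ target t ≟M m' ⌋) ⟩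
      ⌊ source t ≟M m ⌋ ∧ xorSum (monos v (suc k)) (λ m' → ⌊ target t ≟M m' ⌋)
        ≡⟨ cong (⌊ source t ≟M m ⌋ ∧_) (trans (xorSum-cong (monos v (suc k)) (λ m' → ⌊⌋-⇔ (target t ≟M m') (m' ≟M target t) sym sym))
                                              (once-monos v (suc k) (target t) (sum-target t deg))) ⟩
      ⌊ source t ≟M m ⌋ ∧ true
        ≡⟨ ∧-identityʳ _ ⟩
      ⌊ source t ≟M m ⌋ ∎

  -- c is a cycle: the boundary at x is [x canonical] · Σ_t w(t) [source t = η x] = 0
  c-closed : ∀ x → xorSum tuples (c x) ≡ false
  c-closed x = begin
    xorSum tuples (c x)
      ≡⟨ xorSum-linear (triples k) tuples w (λ t → lift t x) ⟩
    xorSum (triples k) (λ t → w t ∧ xorSum tuples (lift t x))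
      ≡⟨ xorSum-congᴬ (triples k) (triples-degree k) (λ t deg →
           cong (w t ∧_) (trans (lift-boundary t deg x) (canon-test a₀ (source t) x (sum-source t deg)))) ⟩
    xorSum (triples k) (λ t → w t ∧ (⌊ x ≟T home (η x) ⌋ ∧ ⌊ source t ≟M η x ⌋))
      ≡⟨ xorSum-cong (triples k) (λ t → ∧-exchange (w t) ⌊ x ≟T home (η x) ⌋ _) ⟩
    xorSum (triples k) (λ t → ⌊ x ≟T home (η x) ⌋ ∧ (w t ∧ ⌊ source t ≟M η x ⌋))
      ≡⟨ xorSum-∧ˡ (triples k) ⌊ x ≟T home (η x) ⌋ (λ t → w t ∧ ⌊ source t ≟M η x ⌋) ⟩
    ⌊ x ≟T home (η x) ⌋ ∧ xorSum (triples k) (λ t → w t ∧ ⌊ source t ≟M η x ⌋)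
      ≡⟨ cong (⌊ x ≟T home (η x) ⌋ ∧_) (weights-at-source (η x)) ⟩
    ⌊ x ≟T home (η x) ⌋ ∧ false
      ≡⟨ ∧-zeroʳ _ ⟩
    false ∎

  c-image : ∀ m m' → etaStar c m m' ≡ d m m'
  c-image m m' = image-if (m ≟M m')
    where
    image-if : (eq? : Dec (m ≡ m')) → (if ⌊ eq? ⌋ then false else pairing tuples all-once (over m) (over m') c) ≡ d m m'
    image-if (yes refl) = sym (no-loops d d-supported m)
    image-if (no  _)    = begin
      pairing tuples all-once (over m) (over m') c
        ≡⟨ pairing-linear tuples all-once (triples k) w lift (over m) (over m') ⟩
      xorSum (triples k) (λ t → w t ∧ pairing tuples all-once (over m) (over m') (lift t))
        ≡⟨ xorSum-congᴬ (triples k) (triples-degree k) (λ t deg → cong (w t ∧_) (lift-image t deg m m')) ⟩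
      xorSum (triples k) (λ t → w t ∧ (⌊ source t ≟M m ⌋ ∧ ⌊ target t ≟M m' ⌋))
        ≡⟨ sum-of-arcs d d-supported m m' ⟩
      d m m' ∎

  -- c is symmetric: the arcs part is invariant under reversing all arcs, the detours are symmetric
  c-sym : ∀ x y → c x y ≡ c y x
  c-sym x y = begin
    c x y
      ≡⟨ xorSum-weighted-xor (triples k) w (λ t → arc (tail-lift t) (head-lift t) x y) (λ t → chain (detour t) x y) ⟩
    xorSum (triples k) (λ t → w t ∧ arc (tail-lift t) (head-lift t) x y) xor xorSum (triples k) (λ t → w t ∧ chain (detour t) x y)
      ≡⟨ cong₂ _xor_ (trans (xorSum-cong (triples k) reversed) (xorSum-reverse k (λ t → w t ∧ arc (tail-lift t) (head-lift t) y x)))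
                     (xorSum-cong (triples k) (λ t → cong (w t ∧_) (chain-sym (detour t) x y))) ⟩
    xorSum (triples k) (λ t → w t ∧ arc (tail-lift t) (head-lift t) y x) xor xorSum (triples k) (λ t → w t ∧ chain (detour t) y x)
      ≡⟨ sym (xorSum-weighted-xor (triples k) w (λ t → arc (tail-lift t) (head-lift t) y x) (λ t → chain (detour t) y x)) ⟩
    c y x ∎
    where
    reversed : ∀ t → w t ∧ arc (tail-lift t) (head-lift t) x y ≡ w (reverse t) ∧ arc (tail-lift (reverse t)) (head-lift (reverse t)) y x
    reversed t@(i , j , f) = cong₂ _∧_ (cong₂ _∧_ (sym-adj i j) (d-sym (source t) (target t)))
                                       (∧-comm ⌊ x ≟T tail-lift t ⌋ _)

  -- c is supported on edges of G^(k+1): lifted arcs are edges, and so are the edges of the detours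
  c-supported : ∀ x y → c x y ≡ true → powAdj adj x y ≡ true
  c-supported x y e with t , _ , hit ← xorSum-witness (triples k) (λ t → w t ∧ lift t x y) (triples-degree k) e
                     with xor-true (proj₂ (∧-true {w t} hit))
  ... | inj₁ on-arc   = let x≡ , y≡ = ∧-true on-arc in
    subst₂ (λ p q → powAdj adj p q ≡ true) (sym (⌊⌋-sound (x ≟T tail-lift t) x≡)) (sym (⌊⌋-sound (y ≟T head-lift t) y≡))
           (powAdj-head adj (canon a₀ k (proj₂ (proj₂ t))) (proj₁ (∧-true (proj₁ (∧-true {w t} hit)))))
  ... | inj₂ on-chain = chain-support (powAdj adj) (powAdj-sym adj sym-adj) (detour t) (detour-adjacent t) x y on-chain

lemma1 : (v : ℕ) (adj : Fin v → Fin v → Bool) →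
         SymmetricAdj adj → IrreflexiveAdj adj → Connected adj →
         (k : ℕ) → 1 ≤ k →
         (d : EdgeFn (Vec ℕ v)) → IsCycle (Red v adj k) d →
         Σ (EdgeFn (Vec (Fin v) k)) (λ c →
           IsCycle (Pow v adj k) c × (∀ m m' → etaStar c m m' ≡ d m m'))
-- the graph without vertices: G^(k) has no edges, so d = 0 lifts to 0
lemma1 zero    adj sym-adj loopless connected k 1≤k d cycle =
  (λ _ _ → false) , (((λ _ _ → refl) , (λ _ _ ())) , (λ _ → xorSum-zero (allTuples 0 k) (λ _ → refl))) , zero-image
  where
  zero-image : ∀ m m' → etaStar {k = k} (λ _ _ → false) m m' ≡ d m m'
  zero-image [] [] with d [] [] in d≡
  ... | false = refl
  ... | true  with () ← proj₂ (proj₁ cycle) [] [] d≡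
lemma1 (suc v) adj sym-adj loopless connected (suc k) 1≤k d cycle =
  c , ((c-sym , c-supported) , c-closed) , c-image
  where open Lift adj sym-adj loopless connected fz k d cycle
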